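{- There exists a linear $DPL(11,6)$ code in $\mathbb{Z}^{11}$.
   Context: Lee distance on $\mathbb{Z}^n$: $d_L(u,v)=\sum_i|u_i-v_i|$. A $DPL(n,d)$ code is a set $C\subseteq\mathbb{Z}^n$ with $d_L(u,v)\ge d$ for all distinct $u,v\in C$, such that there is a partition $\{W_i\}$ of $\mathbb{Z}^n$ into sets each of which is a diameter $d-1$ anticode (all pairwise Lee distances $\le d-1$) of maximum possible cardinality, with $|C\cap W_i|=1$ for all $i$ and $C\cap W_i\ne C\cap W_j$ for $i\neq j$; it is linear if $C$ is a subgroup of $\mathbb{Z}^n$. -}

module Defs where

open import Data.Nat using (ℕ; _≤_; _≥_; _∸_)
open import Data.Integer as ℤ using (ℤ; ∣_∣; _-_)
import Data.Integer as Int
open import Data.Vec using (Vec; zipWith; sum; replicate)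
open import Data.List using (List; length)
open import Data.List.Membership.Propositional using (_∈_)
open import Data.List.Relation.Unary.Unique.Propositional using (Unique)
open import Data.Product using (Σ; _×_; ∃; ∃-syntax)
open import Relation.Binary.PropositionalEquality using (_≡_; _≢_)
open import Level using (suc; zero)

dL : ∀ {n} → Vec ℤ n → Vec ℤ n → ℕ
dL u v = sum (zipWith (λ a b → ∣ a - b ∣) u v)

_⊕_ : ∀ {n} → Vec ℤ n → Vec ℤ n → Vec ℤ n
u ⊕ v = zipWith Int._+_ u v

⊖_ : ∀ {n} → Vec ℤ n → Vec ℤ n
⊖ u = Data.Vec.map Int.-_ u
  where import Data.Vec

𝟎 : ∀ {n} → Vec ℤ n
𝟎 = replicate _ (Int.+ 0)

-- A (finite) anticode of diameter D: a duplicate-free list of points of ℤ^n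
-- with all pairwise Lee distances ≤ D.  (Anticodes of finite diameter are finite.)
IsAnticode : ∀ n → ℕ → List (Vec ℤ n) → Set
IsAnticode n D A = Unique A × (∀ {u v} → u ∈ A → v ∈ A → dL u v ≤ D)

IsMaxAnticode : ∀ n → ℕ → List (Vec ℤ n) → Set
IsMaxAnticode n D W =
  IsAnticode n D W × (∀ (A : List (Vec ℤ n)) → IsAnticode n D A → length A ≤ length W)

CodeDist : ∀ n → ℕ → (Vec ℤ n → Set) → Set
CodeDist n d C = ∀ {u v} → C u → C v → u ≢ v → dL u v ≥ d

IsSubgroup : ∀ n → (Vec ℤ n → Set) → Set
IsSubgroup n C = C 𝟎 × (∀ {u v} → C u → C v → C (u ⊕ v)) × (∀ {u} → C u → C (⊖ u))

IsDPLPartition : ∀ n d → (Vec ℤ n → Set) → (I : Set) → (I → List (Vec ℤ n)) → Set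
IsDPLPartition n d C I W =
    (∀ i → IsMaxAnticode n (d ∸ 1) (W i))
  × (∀ x → ∃[ i ] (x ∈ W i))
  × (∀ {x i j} → x ∈ W i → x ∈ W j → i ≡ j)
  × (∀ i → ∃[ c ] (c ∈ W i × C c × (∀ {c'} → c' ∈ W i → C c' → c' ≡ c)))
  × (∀ {i j c c'} → i ≢ j → c ∈ W i → C c → c' ∈ W j → C c' → c ≢ c')

IsDPL : ∀ n d → (Vec ℤ n → Set) → Set₁
IsDPL n d C = CodeDist n d C × Σ Set (λ I → Σ (I → List (Vec ℤ n)) (λ W → IsDPLPartition n d C I W))

IsLinearDPL : ∀ n d → (Vec ℤ n → Set) → Set₁
IsLinearDPL n d C = IsSubgroup n C × IsDPL n d C

{-# OPTIONS --safe #-}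

-- The code is the kernel C of the homomorphism ℤ¹¹ → ℤ₂ × ℤ₃⁵ that sends eᵢ to the i-th column
-- of a matrix whose first row is all ones (mod 2) and whose other rows form a parity-check
-- matrix of the ternary Golay code (mod 3).  An exhaustive search of the Lee ball of radius 5
-- shows that C has minimum Lee distance 6.  The double ball B₂(0) ∪ B₂(e₁) has diameter 5, so
-- the syndrome is injective on it; having 486 = |ℤ₂ × ℤ₃⁵| points, it is therefore a transversal
-- of C, and its translates by C tile ℤ¹¹ with one codeword each.  Injectivity of the syndrome on
-- every anticode of diameter 5 bounds its size by 486, so the tiles are maximum anticodes.

module Submission where

open import Defs
open import Algebra.Bundles using (AbelianGroup)
open import Algebra.Structures using (IsAbelianGroup)
import Algebra.Properties.CommutativeSemigroup as CommutativeSemigroupProperties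
import Algebra.Properties.Group as GroupProperties
open import Axiom.UniquenessOfIdentityProofs using (module Decidable⇒UIP)
open import Data.Bool using (Bool; true; false; T; _∧_; _∨_)
open import Data.Bool.ListAction using (any)
open import Data.Bool.Properties using (T-∧; T-∨)
open import Data.Integer as ℤ using (ℤ; +_; -[1+_]; +[1+_]; ∣_∣)
import Data.Integer.Properties as ℤP
open import Data.Integer.DivMod using (_%ℕ_; _/ℕ_; a≡a%ℕn+[a/ℕn]*n; n%ℕd<d)
open import Data.Integer.Divisibility.Signed using (_∣_; divides; ∣⇒∣ᵤ; ∣m∣n⇒∣m-n; ∣m∣n⇒∣m+n)
open import Data.Integer.Tactic.RingSolver using (solve-∀)
open import Data.Nat as ℕ using (ℕ; zero; suc; _+_; _∸_; _≤_; _<_; _≤?_; _<?_; z≤n; s≤s; NonZero)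
import Data.Nat.Properties as ℕP
open import Data.Nat.DivMod using (m<n⇒m%n≡m)
open import Data.Nat.Divisibility as ℕDiv using (>⇒∤)
open import Data.List as L using (List; []; _∷_; _++_; length; upTo; concatMap; filter; cartesianProductWith)
import Data.List.Properties as LP
open import Data.List.Membership.Propositional using (_∈_; _─_; find; lose)
open import Data.List.Membership.Propositional.Properties
  using (∈-map⁺; ∈-map⁻; ∈-++⁺ˡ; ∈-++⁺ʳ; ∈-++⁻; ∈-upTo⁺; ∈-upTo⁻; ∈-concatMap⁻; ∈-filter⁻; ∈-cartesianProductWith⁺)
import Data.List.Membership.DecPropositional as DecMembership
open import Data.List.Relation.Binary.Disjoint.Propositional using (Disjoint)
open import Data.List.Relation.Binary.Subset.Propositional using (_⊆_)
open import Data.List.Relation.Unary.All as All using (All)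
import Data.List.Relation.Unary.All.Properties as AllP
import Data.List.Relation.Unary.AllPairs as AllPairs
import Data.List.Relation.Unary.AllPairs.Properties as AllPairsP
open import Data.List.Relation.Unary.Any using (here; there; index)
open import Data.List.Relation.Unary.Any.Properties using (any⁺)
open import Data.List.Relation.Unary.Unique.Propositional using (Unique; []; _∷_)
import Data.List.Relation.Unary.Unique.Propositional.Properties as UniqueP
open import Data.Product using (Σ; ∃-syntax; _×_; _,_; proj₁; proj₂)
open import Data.Sum using (_⊎_; inj₁; inj₂)
open import Data.Vec as V using (Vec; []; _∷_)
import Data.Vec.Properties as VP
open import Function using (_∘_; Equivalence)
open import Level using (0ℓ)
open import Relation.Binary.Definitions using (DecidableEquality)
open import Relation.Binary.PropositionalEquality
open import Relation.Nullary using (¬_; yes; no; contradiction)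
open import Relation.Nullary.Decidable using (⌊_⌋; fromWitness)

-- The group ℤⁿ and the Lee metric

ℤⁿ-isAbelianGroup : ∀ n → IsAbelianGroup (_≡_ {A = Vec ℤ n}) _⊕_ 𝟎 ⊖_
ℤⁿ-isAbelianGroup n = record
  { isGroup = record
    { isMonoid = record
      { isSemigroup = record
        { isMagma = record { isEquivalence = isEquivalence ; ∙-cong = cong₂ _⊕_ }
        ; assoc = VP.zipWith-assoc ℤP.+-assoc
        }
      ; identity = VP.zipWith-identityˡ ℤP.+-identityˡ , VP.zipWith-identityʳ ℤP.+-identityʳ
      }
    ; inverse = VP.zipWith-inverseˡ ℤP.+-inverseˡ , VP.zipWith-inverseʳ ℤP.+-inverseʳ
    ; ⁻¹-cong = cong ⊖_
    }
  ; comm = VP.zipWith-comm ℤP.+-comm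
  }

ℤⁿ-abelianGroup : ℕ → AbelianGroup 0ℓ 0ℓ
ℤⁿ-abelianGroup n = record { isAbelianGroup = ℤⁿ-isAbelianGroup n }

module ℤⁿ (n : ℕ) where
  open AbelianGroup (ℤⁿ-abelianGroup n) public using (assoc; identityˡ; identityʳ; inverseʳ)
  open GroupProperties (AbelianGroup.group (ℤⁿ-abelianGroup n)) public
    using (∙-cancelˡ; ∙-cancelʳ; x∙y⁻¹≈ε⇒x≈y; //-rightDividesˡ)
  open CommutativeSemigroupProperties (AbelianGroup.commutativeSemigroup (ℤⁿ-abelianGroup n)) public
    using (interchange)

leeWeight : ∀ {n} → Vec ℤ n → ℕ
leeWeight x = V.sum (V.map ∣_∣ x)

dL≡leeWeight : ∀ {n} (u v : Vec ℤ n) → dL u v ≡ leeWeight (u ⊕ (⊖ v))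
dL≡leeWeight []      []      = refl
dL≡leeWeight (a ∷ u) (b ∷ v) = cong (_+_ ∣ a ℤ.- b ∣) (dL≡leeWeight u v)

dL-sym : ∀ {n} (u v : Vec ℤ n) → dL u v ≡ dL v u
dL-sym []      []      = refl
dL-sym (a ∷ u) (b ∷ v) = cong₂ _+_ (ℤP.∣i-j∣≡∣j-i∣ a b) (dL-sym u v)

∣-∣-triangle : ∀ a b c → ∣ a ℤ.- c ∣ ≤ ∣ a ℤ.- b ∣ + ∣ b ℤ.- c ∣
∣-∣-triangle a b c =
  subst (λ z → ∣ z ∣ ≤ ∣ a ℤ.- b ∣ + ∣ b ℤ.- c ∣) (split a b c) (ℤP.∣i+j∣≤∣i∣+∣j∣ (a ℤ.- b) (b ℤ.- c))
  where
  split : ∀ a b c → (a ℤ.- b) ℤ.+ (b ℤ.- c) ≡ a ℤ.- c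
  split = solve-∀

dL-triangle : ∀ {n} (u v w : Vec ℤ n) → dL u w ≤ dL u v + dL v w
dL-triangle []      []      []      = z≤n
dL-triangle (a ∷ u) (b ∷ v) (c ∷ w) = begin
  ∣ a ℤ.- c ∣ + dL u w                                ≤⟨ ℕP.+-mono-≤ (∣-∣-triangle a b c) (dL-triangle u v w) ⟩
  (∣ a ℤ.- b ∣ + ∣ b ℤ.- c ∣) + (dL u v + dL v w)     ≡⟨ interchange (∣ a ℤ.- b ∣) (∣ b ℤ.- c ∣) (dL u v) (dL v w) ⟩
  (∣ a ℤ.- b ∣ + dL u v) + (∣ b ℤ.- c ∣ + dL v w)     ∎
  where
  open ℕP.≤-Reasoning
  open CommutativeSemigroupProperties ℕP.+-commutativeSemigroup using (interchange)

dL-translate : ∀ {n} (c u v : Vec ℤ n) → dL (c ⊕ u) (c ⊕ v) ≡ dL u v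
dL-translate []       []      []      = refl
dL-translate (c ∷ cs) (a ∷ u) (b ∷ v) = cong₂ _+_ (cong ∣_∣ (cancel c a b)) (dL-translate cs u v)
  where
  cancel : ∀ c a b → (c ℤ.+ a) ℤ.- (c ℤ.+ b) ≡ a ℤ.- b
  cancel = solve-∀

dL-self : ∀ {n} (x : Vec ℤ n) → dL x x ≡ 0
dL-self []      = refl
dL-self (a ∷ x) = cong₂ _+_ (cong ∣_∣ (ℤP.+-inverseʳ a)) (dL-self x)

dL-𝟎 : ∀ {n} (x : Vec ℤ n) → dL x 𝟎 ≡ leeWeight x
dL-𝟎 []      = refl
dL-𝟎 (a ∷ x) = cong₂ _+_ (cong ∣_∣ (ℤP.+-identityʳ a)) (dL-𝟎 x)

dL-via-centres : ∀ {n} (x y p q : Vec ℤ n) {r δ} →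
                 dL x p ≤ r → dL y q ≤ r → dL p q ≤ δ → dL x y ≤ r + δ + r
dL-via-centres x y p q {r} {δ} xp≤r yq≤r pq≤δ = begin
  dL x y                      ≤⟨ dL-triangle x p y ⟩
  dL x p + dL p y             ≤⟨ ℕP.+-monoʳ-≤ (dL x p) (dL-triangle p q y) ⟩
  dL x p + (dL p q + dL q y)  ≤⟨ ℕP.+-mono-≤ xp≤r (ℕP.+-mono-≤ pq≤δ (subst (_≤ r) (dL-sym y q) yq≤r)) ⟩
  r + (δ + r)                 ≡⟨ ℕP.+-assoc r δ r ⟨
  r + δ + r                   ∎
  where open ℕP.≤-Reasoning

-- Counting in duplicate-free lists

module _ {A : Set} where

  ∈-─⁺ : ∀ {x y : A} {ys} (x∈ys : x ∈ ys) → y ∈ ys → y ≢ x → y ∈ ys ─ x∈ys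
  ∈-─⁺ (here refl)   (here refl)   y≢x = contradiction refl y≢x
  ∈-─⁺ (here _)      (there y∈ys)  _   = y∈ys
  ∈-─⁺ (there _)     (here y≡z)    _   = here y≡z
  ∈-─⁺ (there x∈ys)  (there y∈ys)  y≢x = there (∈-─⁺ x∈ys y∈ys y≢x)

  Unique-map⁺-injectiveOn : ∀ {B : Set} (f : A → B) {xs} →
                            (∀ {x y} → x ∈ xs → y ∈ xs → f x ≡ f y → x ≡ y) →
                            Unique xs → Unique (L.map f xs)
  Unique-map⁺-injectiveOn f inj []           = []
  Unique-map⁺-injectiveOn f inj (x∉xs ∷ xs!) =
    AllP.map⁺ (All.tabulate λ y∈xs fx≡fy → All.lookup x∉xs y∈xs (inj (here refl) (there y∈xs) fx≡fy))
    ∷ Unique-map⁺-injectiveOn f (λ x∈ y∈ → inj (there x∈) (there y∈)) xs!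

  Unique-⊆⇒length≤ : ∀ {xs ys : List A} → Unique xs → xs ⊆ ys → length xs ≤ length ys
  Unique-⊆⇒length≤ {[]}          _             _     = z≤n
  Unique-⊆⇒length≤ {x ∷ xs} {ys} (x∉xs ∷ xs!) xs⊆ys = begin
    suc (length xs)          ≤⟨ s≤s (Unique-⊆⇒length≤ xs! xs⊆ys─x) ⟩
    suc (length (ys ─ x∈ys)) ≡⟨ LP.length-removeAt′ ys (index x∈ys) ⟨
    length ys                ∎
    where
    open ℕP.≤-Reasoning
    x∈ys = xs⊆ys (here refl)
    xs⊆ys─x : xs ⊆ ys ─ x∈ys
    xs⊆ys─x y∈xs = ∈-─⁺ x∈ys (xs⊆ys (there y∈xs)) λ y≡x → All.lookup x∉xs y∈xs (sym y≡x)

  Unique-⊆-length≥⇒⊇ : DecidableEquality A → ∀ {xs ys : List A} →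
                       Unique xs → xs ⊆ ys → length ys ≤ length xs → ys ⊆ xs
  Unique-⊆-length≥⇒⊇ _≟_ {xs} {ys} xs! xs⊆ys ys≤xs {y} y∈ys with y ∈? xs
    where open DecMembership _≟_ using (_∈?_)
  ... | yes y∈xs = y∈xs
  ... | no  y∉xs = contradiction (ℕP.≤-trans ys≤xs (Unique-⊆⇒length≤ xs! xs⊆ys─y)) (ℕP.<⇒≱ ys─y<ys)
    where
    xs⊆ys─y : xs ⊆ ys ─ y∈ys
    xs⊆ys─y {z} z∈xs = ∈-─⁺ y∈ys (xs⊆ys z∈xs) λ z≡y → y∉xs (subst (_∈ xs) z≡y z∈xs)
    ys─y<ys : length (ys ─ y∈ys) < length ys
    ys─y<ys = ℕP.≤-reflexive (sym (LP.length-removeAt′ ys (index y∈ys)))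

-- Kernels of ⊕-compatible maps

⊕-Compatible : ∀ {n} {R : Set} → (Vec ℤ n → R) → Set
⊕-Compatible s = ∀ {u u′ v v′} → s u ≡ s u′ → s v ≡ s v′ → s (u ⊕ v) ≡ s (u′ ⊕ v′)

module CompatibleMap {n : ℕ} {R : Set} (s : Vec ℤ n → R) (s-compat : ⊕-Compatible s) where

  open ℤⁿ n using (identityˡ; inverseʳ; ∙-cancelˡ; ∙-cancelʳ; x∙y⁻¹≈ε⇒x≈y; //-rightDividesˡ)

  Kernel : Vec ℤ n → Set
  Kernel x = s x ≡ s 𝟎

  s-kernel-⊕ : ∀ {c} → Kernel c → ∀ y → s (c ⊕ y) ≡ s y
  s-kernel-⊕ c∈K y = trans (s-compat c∈K refl) (cong s (identityˡ y))

  s-≡⇒kernel : ∀ {u v} → s u ≡ s v → Kernel (u ⊕ (⊖ v))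
  s-≡⇒kernel {v = v} su≡sv = trans (s-compat su≡sv refl) (cong s (inverseʳ v))

  kernel-isSubgroup : IsSubgroup n Kernel
  kernel-isSubgroup =
    refl ,
    (λ {u} u∈K v∈K → trans (s-kernel-⊕ u∈K _) v∈K) ,
    (λ {u} u∈K → subst Kernel (identityˡ (⊖ u)) (s-≡⇒kernel (sym u∈K)))

  module Tiling (_≟_ : DecidableEquality R) {d : ℕ}
    (L : List R) (L-unique : Unique L) (s∈L : ∀ x → s x ∈ L)
    (D : List (Vec ℤ n)) (D-anticode : IsAnticode n d D) (L≤D : length L ≤ length D)
    (kernel-weight : ∀ {x} → Kernel x → x ≢ 𝟎 → suc d ≤ leeWeight x)
    where

    kernel-distance : ∀ {u v} → s u ≡ s v → u ≢ v → suc d ≤ dL u v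
    kernel-distance {u} {v} su≡sv u≢v = subst (suc d ≤_) (sym (dL≡leeWeight u v))
      (kernel-weight (s-≡⇒kernel su≡sv) (u≢v ∘ x∙y⁻¹≈ε⇒x≈y u v))

    s-injective-on-anticode : ∀ {A a b} → IsAnticode n d A → a ∈ A → b ∈ A → s a ≡ s b → a ≡ b
    s-injective-on-anticode {a = a} {b} (_ , diam) a∈A b∈A sa≡sb with VP.≡-dec ℤP._≟_ a b
    ... | yes a≡b = a≡b
    ... | no  a≢b = contradiction (ℕP.≤-trans (kernel-distance sa≡sb a≢b) (diam a∈A b∈A)) (ℕP.n≮n d)

    map-s⊆L : ∀ X → L.map s X ⊆ L
    map-s⊆L X r∈sX with _ , _ , refl ← ∈-map⁻ s r∈sX = s∈L _

    anticode-length≤ : ∀ {A} → IsAnticode n d A → length A ≤ length L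
    anticode-length≤ {A} A-anticode@(A-unique , _) = begin
      length A            ≡⟨ LP.length-map s A ⟨
      length (L.map s A)  ≤⟨ Unique-⊆⇒length≤ sA-unique (map-s⊆L A) ⟩
      length L            ∎
      where
      open ℕP.≤-Reasoning
      sA-unique = Unique-map⁺-injectiveOn s (s-injective-on-anticode {A} A-anticode) A-unique

    L⊆map-s-D : L ⊆ L.map s D
    L⊆map-s-D = Unique-⊆-length≥⇒⊇ _≟_
      (Unique-map⁺-injectiveOn s (s-injective-on-anticode {D} D-anticode) (proj₁ D-anticode))
      (map-s⊆L D) (subst (length L ≤_) (sym (LP.length-map s D)) L≤D)

    D-transversal : ∀ x → ∃[ w ] (w ∈ D × s w ≡ s x)
    D-transversal x with w , w∈D , sx≡sw ← ∈-map⁻ s (L⊆map-s-D (s∈L x)) = w , w∈D , sym sx≡sw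

    Index : Set
    Index = Σ (Vec ℤ n) Kernel

    Index-≡ : ∀ {i j : Index} → proj₁ i ≡ proj₁ j → i ≡ j
    Index-≡ {c , p} {.c , q} refl = cong (c ,_) (Decidable⇒UIP.≡-irrelevant _≟_ p q)

    tile : Index → List (Vec ℤ n)
    tile (c , _) = L.map (c ⊕_) D

    s-tile : ∀ {x} (i : Index) → x ∈ tile i → ∃[ w ] (w ∈ D × x ≡ proj₁ i ⊕ w × s x ≡ s w)
    s-tile (c , c∈K) x∈tile with w , w∈D , refl ← ∈-map⁻ (c ⊕_) x∈tile = w , w∈D , refl , s-kernel-⊕ c∈K w

    tile-isMaxAnticode : ∀ i → IsMaxAnticode n d (tile i)
    tile-isMaxAnticode i@(c , _) = (UniqueP.map⁺ (∙-cancelˡ c _ _) (proj₁ D-anticode) , diam) , maximal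
      where
      diam : ∀ {u v} → u ∈ tile i → v ∈ tile i → dL u v ≤ d
      diam u∈ v∈ with s-tile i u∈ | s-tile i v∈
      ... | w , w∈D , refl , _ | w′ , w′∈D , refl , _ =
        subst (_≤ d) (sym (dL-translate c w w′)) (proj₂ D-anticode w∈D w′∈D)
      maximal : ∀ A → IsAnticode n d A → length A ≤ length (tile i)
      maximal A A-anticode = ℕP.≤-trans (anticode-length≤ {A} A-anticode)
        (subst (length L ≤_) (sym (LP.length-map (c ⊕_) D)) L≤D)

    tiles-cover : ∀ x → ∃[ i ] (x ∈ tile i)
    tiles-cover x with w , w∈D , sw≡sx ← D-transversal x =
      (x ⊕ (⊖ w) , s-≡⇒kernel (sym sw≡sx)) ,
      subst (_∈ L.map ((x ⊕ (⊖ w)) ⊕_) D) (//-rightDividesˡ w x) (∈-map⁺ ((x ⊕ (⊖ w)) ⊕_) w∈D)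

    tiles-disjoint : ∀ {x} {i j : Index} → x ∈ tile i → x ∈ tile j → i ≡ j
    tiles-disjoint {i = i} {j} x∈i x∈j with s-tile i x∈i | s-tile j x∈j
    ... | w , w∈D , x≡cw , sx≡sw | w′ , w′∈D , x≡c′w′ , sx≡sw′ = Index-≡ (∙-cancelʳ w _ _ c⊕w≡c′⊕w)
      where
      w≡w′ : w ≡ w′
      w≡w′ = s-injective-on-anticode {D} D-anticode w∈D w′∈D (trans (sym sx≡sw) sx≡sw′)
      c⊕w≡c′⊕w : proj₁ i ⊕ w ≡ proj₁ j ⊕ w
      c⊕w≡c′⊕w = trans (sym x≡cw) (trans x≡c′w′ (cong (proj₁ j ⊕_) (sym w≡w′)))

    tile-codeword : ∀ i → ∃[ c ] (c ∈ tile i × Kernel c × (∀ {c′} → c′ ∈ tile i → Kernel c′ → c′ ≡ c))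
    tile-codeword i@(c , c∈K) with w₀ , w₀∈D , sw₀≡s𝟎 ← D-transversal 𝟎 =
      c ⊕ w₀ , ∈-map⁺ _ w₀∈D , trans (s-kernel-⊕ c∈K w₀) sw₀≡s𝟎 , unique
      where
      unique : ∀ {c′} → c′ ∈ tile i → Kernel c′ → c′ ≡ c ⊕ w₀
      unique c′∈ c′∈K with w , w∈D , refl , sc′≡sw ← s-tile i c′∈ =
        cong (c ⊕_) (s-injective-on-anticode {D} D-anticode w∈D w₀∈D
          (trans (sym sc′≡sw) (trans c′∈K (sym sw₀≡s𝟎))))

    kernel-isLinearDPL : IsLinearDPL n (suc d) Kernel
    kernel-isLinearDPL =
      kernel-isSubgroup ,
      (λ u∈K v∈K u≢v → kernel-distance (trans u∈K (sym v∈K)) u≢v) ,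
      Index , tile ,
      tile-isMaxAnticode , tiles-cover , tiles-disjoint , tile-codeword ,
      (λ {_} {j} i≢j c∈i _ c′∈j _ c≡c′ → i≢j (tiles-disjoint c∈i (subst (_∈ tile j) (sym c≡c′) c′∈j)))

-- Lee balls

range : ℕ → List ℤ
range b = L.map +_ (upTo (suc b)) ++ L.map -[1+_] (upTo b)

range-unique : ∀ b → Unique (range b)
range-unique b = UniqueP.++⁺ (UniqueP.map⁺ ℤP.+-injective (UniqueP.upTo⁺ (suc b)))
                             (UniqueP.map⁺ ℤP.-[1+-injective (UniqueP.upTo⁺ b)) nonneg#neg
  where
  nonneg#neg : Disjoint (L.map +_ (upTo (suc b))) (L.map -[1+_] (upTo b))
  nonneg#neg (t∈+ , t∈-) with _ , _ , refl ← ∈-map⁻ +_ t∈+ with _ , _ , () ← ∈-map⁻ -[1+_] t∈-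

∣∣≤⇒∈range : ∀ {b} t → ∣ t ∣ ≤ b → t ∈ range b
∣∣≤⇒∈range (+ m)    m≤b = ∈-++⁺ˡ (∈-map⁺ +_ (∈-upTo⁺ (s≤s m≤b)))
∣∣≤⇒∈range -[1+ m ] m<b = ∈-++⁺ʳ _ (∈-map⁺ -[1+_] (∈-upTo⁺ m<b))

∈range⇒∣∣≤ : ∀ {b t} → t ∈ range b → ∣ t ∣ ≤ b
∈range⇒∣∣≤ {b} t∈ with ∈-++⁻ (L.map +_ (upTo (suc b))) t∈
... | inj₁ t∈+ with _ , m<1+b , refl ← ∈-map⁻ +_ t∈+ = ℕP.≤-pred (∈-upTo⁻ m<1+b)
... | inj₂ t∈- with _ , m<b , refl ← ∈-map⁻ -[1+_] t∈- = ∈-upTo⁻ m<b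

ball : ∀ n → ℕ → List (Vec ℤ n)
ball zero    b = [] ∷ []
ball (suc n) b = concatMap (λ t → L.map (t ∷_) (ball n (b ∸ ∣ t ∣))) (range b)

∈ball⇒leeWeight≤ : ∀ {n b x} → x ∈ ball n b → leeWeight x ≤ b
∈ball⇒leeWeight≤ {zero}  {x = []} _ = z≤n
∈ball⇒leeWeight≤ {suc n} {b} x∈ with t , t∈ , x∈t ← find (∈-concatMap⁻ _ {xs = range b} x∈)
                                 with y , y∈ , refl ← ∈-map⁻ (t ∷_) x∈t = begin
  ∣ t ∣ + leeWeight y  ≤⟨ ℕP.+-monoʳ-≤ ∣ t ∣ (∈ball⇒leeWeight≤ y∈) ⟩
  ∣ t ∣ + (b ∸ ∣ t ∣)  ≡⟨ ℕP.m+[n∸m]≡n (∈range⇒∣∣≤ t∈) ⟩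
  b                    ∎
  where open ℕP.≤-Reasoning

ball-unique : ∀ n b → Unique (ball n b)
ball-unique zero    b = All.[] ∷ []
ball-unique (suc n) b = UniqueP.concat⁺
  (AllP.map⁺ (All.universal (λ t → UniqueP.map⁺ VP.∷-injectiveʳ (ball-unique n (b ∸ ∣ t ∣))) (range b)))
  (AllPairsP.map⁺ (AllPairs.map heads-differ (range-unique b)))
  where
  heads-differ : ∀ {t t′} → t ≢ t′ →
    Disjoint (L.map (t ∷_) (ball n (b ∸ ∣ t ∣))) (L.map (t′ ∷_) (ball n (b ∸ ∣ t′ ∣)))
  heads-differ t≢t′ (x∈ , x∈′) with _ , _ , refl ← ∈-map⁻ _ x∈ with _ , _ , eq ← ∈-map⁻ _ x∈′ =
    t≢t′ (VP.∷-injectiveˡ eq)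

module _ {n : ℕ} where

  open ℤⁿ n using (identityʳ; ∙-cancelˡ)

  doubleBall : Vec ℤ n → ℕ → List (Vec ℤ n)
  doubleBall a r = ball n r ++ filter (λ x → r <? leeWeight x) (L.map (a ⊕_) (ball n r))

  ∈doubleBall⇒near-centre : ∀ {a r x} → x ∈ doubleBall a r → dL x 𝟎 ≤ r ⊎ dL x a ≤ r
  ∈doubleBall⇒near-centre {a} {r} {x} x∈ with ∈-++⁻ (ball n r) x∈
  ... | inj₁ x∈ball = inj₁ (subst (_≤ r) (sym (dL-𝟎 x)) (∈ball⇒leeWeight≤ x∈ball))
  ... | inj₂ x∈filter with y , y∈ball , refl ← ∈-map⁻ (a ⊕_) (proj₁ (∈-filter⁻ _ x∈filter)) =
    inj₂ (subst (_≤ r) (sym dL[a⊕y,a]≡∣y∣) (∈ball⇒leeWeight≤ y∈ball))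
    where
    dL[a⊕y,a]≡∣y∣ : dL (a ⊕ y) a ≡ leeWeight y
    dL[a⊕y,a]≡∣y∣ = begin
      dL (a ⊕ y) a        ≡⟨ cong (dL (a ⊕ y)) (identityʳ a) ⟨
      dL (a ⊕ y) (a ⊕ 𝟎)  ≡⟨ dL-translate a y 𝟎 ⟩
      dL y 𝟎              ≡⟨ dL-𝟎 y ⟩
      leeWeight y         ∎
      where open ≡-Reasoning

  doubleBall-unique : ∀ a r → Unique (doubleBall a r)
  doubleBall-unique a r = UniqueP.++⁺ (ball-unique n r)
    (UniqueP.filter⁺ _ (UniqueP.map⁺ (∙-cancelˡ a _ _) (ball-unique n r))) ball#filter
    where
    far? = λ x → r <? leeWeight x
    ball#filter : Disjoint (ball n r) (filter far? (L.map (a ⊕_) (ball n r)))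
    ball#filter (x∈ball , x∈filter) =
      ℕP.<⇒≱ (proj₂ (∈-filter⁻ far? {xs = L.map (a ⊕_) (ball n r)} x∈filter)) (∈ball⇒leeWeight≤ x∈ball)

  doubleBall-isAnticode : ∀ a r → IsAnticode n (r + leeWeight a + r) (doubleBall a r)
  doubleBall-isAnticode a r = doubleBall-unique a r , diameter
    where
    𝟎a≤ : dL 𝟎 a ≤ leeWeight a
    𝟎a≤ = ℕP.≤-reflexive (trans (dL-sym 𝟎 a) (dL-𝟎 a))
    self≤ : ∀ p → dL p p ≤ leeWeight a
    self≤ p = subst (_≤ leeWeight a) (sym (dL-self p)) z≤n
    diameter : ∀ {x y} → x ∈ doubleBall a r → y ∈ doubleBall a r → dL x y ≤ r + leeWeight a + r
    diameter {x} {y} x∈ y∈ with ∈doubleBall⇒near-centre x∈ | ∈doubleBall⇒near-centre y∈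
    ... | inj₁ x~𝟎 | inj₁ y~𝟎 = dL-via-centres x y 𝟎 𝟎 x~𝟎 y~𝟎 (self≤ 𝟎)
    ... | inj₁ x~𝟎 | inj₂ y~a = dL-via-centres x y 𝟎 a x~𝟎 y~a 𝟎a≤
    ... | inj₂ x~a | inj₁ y~𝟎 = dL-via-centres x y a 𝟎 x~a y~𝟎 (ℕP.≤-reflexive (dL-𝟎 a))
    ... | inj₂ x~a | inj₂ y~a = dL-via-centres x y a a x~a y~a (self≤ a)

-- Residues and syndromes

module _ (m : ℕ) .{{_ : NonZero m}} where

  m∣a-a%ℕm : ∀ a → + m ∣ a ℤ.- + (a %ℕ m)
  m∣a-a%ℕm a = divides (a /ℕ m) (begin
    a ℤ.- + r                          ≡⟨ cong (ℤ._- + r) (a≡a%ℕn+[a/ℕn]*n a m) ⟩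
    (+ r ℤ.+ a /ℕ m ℤ.* + m) ℤ.- + r   ≡⟨ cancel (+ r) (a /ℕ m ℤ.* + m) ⟩
    a /ℕ m ℤ.* + m                      ∎)
    where
    open ≡-Reasoning
    r = a %ℕ m
    cancel : ∀ r q → (r ℤ.+ q) ℤ.- r ≡ q
    cancel = solve-∀

  m∣i∧∣i∣<m⇒i≡0 : ∀ {i} → + m ∣ i → ∣ i ∣ < m → i ≡ + 0
  m∣i∧∣i∣<m⇒i≡0 {i} m∣i ∣i∣<m with ∣ i ∣ in ∣i∣≡
  ... | zero  = ℤP.∣i∣≡0⇒i≡0 ∣i∣≡
  ... | suc _ = contradiction (subst (m ℕDiv.∣_) ∣i∣≡ (∣⇒∣ᵤ m∣i)) (>⇒∤ ∣i∣<m)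

  %ℕ-≡⇒∣ : ∀ a b → a %ℕ m ≡ b %ℕ m → + m ∣ a ℤ.- b
  %ℕ-≡⇒∣ a b a≡b = subst (+ m ∣_) (shift a b (+ (b %ℕ m)))
    (∣m∣n⇒∣m-n (subst (λ r → + m ∣ a ℤ.- + r) a≡b (m∣a-a%ℕm a)) (m∣a-a%ℕm b))
    where
    shift : ∀ a b r → (a ℤ.- r) ℤ.- (b ℤ.- r) ≡ a ℤ.- b
    shift = solve-∀

  ∣⇒%ℕ-≡ : ∀ a b → + m ∣ a ℤ.- b → a %ℕ m ≡ b %ℕ m
  ∣⇒%ℕ-≡ a b m∣a-b = ℤP.+-injective (ℤP.i-j≡0⇒i≡j _ _ (m∣i∧∣i∣<m⇒i≡0 m∣ra-rb ∣ra-rb∣<m))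
    where
    ra = a %ℕ m
    rb = b %ℕ m
    rearrange : ∀ a b ra rb → (a ℤ.- b) ℤ.- ((a ℤ.- ra) ℤ.- (b ℤ.- rb)) ≡ ra ℤ.- rb
    rearrange = solve-∀
    m∣ra-rb : + m ∣ + ra ℤ.- + rb
    m∣ra-rb = subst (+ m ∣_) (rearrange a b (+ ra) (+ rb))
      (∣m∣n⇒∣m-n m∣a-b (∣m∣n⇒∣m-n (m∣a-a%ℕm a) (m∣a-a%ℕm b)))
    ∣ra-rb∣<m : ∣ + ra ℤ.- + rb ∣ < m
    ∣ra-rb∣<m = subst (_< m) (cong ∣_∣ (sym (ℤP.m-n≡m⊖n ra rb)))
      (ℕP.≤-<-trans (ℤP.∣m⊝n∣≤m⊔n ra rb) (ℕP.⊔-lub (n%ℕd<d a m) (n%ℕd<d b m)))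

  %ℕ-cong-+ : ∀ {a a′ b b′} → a %ℕ m ≡ a′ %ℕ m → b %ℕ m ≡ b′ %ℕ m →
              (a ℤ.+ b) %ℕ m ≡ (a′ ℤ.+ b′) %ℕ m
  %ℕ-cong-+ {a} {a′} {b} {b′} a≡a′ b≡b′ = ∣⇒%ℕ-≡ (a ℤ.+ b) (a′ ℤ.+ b′)
    (subst (+ m ∣_) (regroup a a′ b b′) (∣m∣n⇒∣m+n (%ℕ-≡⇒∣ a a′ a≡a′) (%ℕ-≡⇒∣ b b′ b≡b′)))
    where
    regroup : ∀ a a′ b b′ → (a ℤ.- a′) ℤ.+ (b ℤ.- b′) ≡ (a ℤ.+ b) ℤ.- (a′ ℤ.+ b′)
    regroup = solve-∀

  %ℕ-idem : ∀ a → (+ (a %ℕ m)) %ℕ m ≡ a %ℕ m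
  %ℕ-idem a = m<n⇒m%n≡m (n%ℕd<d a m)

-- An entry p of a modulus vector stands for the modulus p + 1, so that no modulus is zero.
residues : ∀ {k} → Vec ℕ k → Vec ℤ k → Vec ℕ k
residues ps a = V.zipWith (λ p aᵢ → aᵢ %ℕ suc p) ps a

residues-compat : ∀ {k} (ps : Vec ℕ k) {a a′ b b′} →
                  residues ps a ≡ residues ps a′ → residues ps b ≡ residues ps b′ →
                  residues ps (a ⊕ b) ≡ residues ps (a′ ⊕ b′)
residues-compat []       {[]}    {[]}    {[]}    {[]}    _    _    = refl
residues-compat (p ∷ ps) {a ∷ _} {a′ ∷ _} {b ∷ _} {b′ ∷ _} a≡a′ b≡b′ = cong₂ _∷_
  (%ℕ-cong-+ (suc p) {a} {a′} {b} {b′} (VP.∷-injectiveˡ a≡a′) (VP.∷-injectiveˡ b≡b′))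
  (residues-compat ps (VP.∷-injectiveʳ a≡a′) (VP.∷-injectiveʳ b≡b′))

residues-idem : ∀ {k} (ps : Vec ℕ k) a → residues ps (V.map +_ (residues ps a)) ≡ residues ps a
residues-idem []       []       = refl
residues-idem (p ∷ ps) (a ∷ as) = cong₂ _∷_ (%ℕ-idem (suc p) a) (residues-idem ps as)

residueVectors : ∀ {k} → Vec ℕ k → List (Vec ℕ k)
residueVectors []       = [] ∷ []
residueVectors (p ∷ ps) = cartesianProductWith _∷_ (upTo (suc p)) (residueVectors ps)

residueVectors-unique : ∀ {k} (ps : Vec ℕ k) → Unique (residueVectors ps)
residueVectors-unique []       = All.[] ∷ []
residueVectors-unique (p ∷ ps) =
  UniqueP.cartesianProductWith⁺ _∷_ VP.∷-injective (UniqueP.upTo⁺ (suc p)) (residueVectors-unique ps)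

residues∈residueVectors : ∀ {k} (ps : Vec ℕ k) a → residues ps a ∈ residueVectors ps
residues∈residueVectors []       []       = here refl
residues∈residueVectors (p ∷ ps) (a ∷ as) =
  ∈-cartesianProductWith⁺ _∷_ (∈-upTo⁺ (n%ℕd<d a (suc p))) (residues∈residueVectors ps as)

scale : ∀ {k} → ℤ → Vec ℕ k → Vec ℤ k
scale t = V.map (λ a → t ℤ.* + a)

scale-distribʳ : ∀ {k} t t′ (c : Vec ℕ k) → scale (t ℤ.+ t′) c ≡ scale t c ⊕ scale t′ c
scale-distribʳ t t′ []      = refl
scale-distribʳ t t′ (a ∷ c) = cong₂ _∷_ (ℤP.*-distribʳ-+ (+ a) t t′) (scale-distribʳ t t′ c)

combination : ∀ {k n} → Vec (Vec ℕ k) n → Vec ℤ n → Vec ℤ k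
combination []       []      = 𝟎
combination (c ∷ cs) (t ∷ x) = scale t c ⊕ combination cs x

combination-⊕ : ∀ {k n} (cs : Vec (Vec ℕ k) n) u v →
                combination cs (u ⊕ v) ≡ combination cs u ⊕ combination cs v
combination-⊕ {k} []       []      []      = sym (identityˡ 𝟎)
  where open ℤⁿ k using (identityˡ)
combination-⊕ {k} (c ∷ cs) (t ∷ u) (t′ ∷ v) = begin
  scale (t ℤ.+ t′) c ⊕ combination cs (u ⊕ v)
    ≡⟨ cong₂ _⊕_ (scale-distribʳ t t′ c) (combination-⊕ cs u v) ⟩
  (scale t c ⊕ scale t′ c) ⊕ (combination cs u ⊕ combination cs v)
    ≡⟨ interchange _ _ _ _ ⟩
  (scale t c ⊕ combination cs u) ⊕ (scale t′ c ⊕ combination cs v)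
    ∎
  where
  open ≡-Reasoning
  open ℤⁿ k using (interchange)

syndrome : ∀ {k n} → Vec ℕ k → Vec (Vec ℕ k) n → Vec ℤ n → Vec ℕ k
syndrome ps cs x = residues ps (combination cs x)

syndrome-compat : ∀ {k n} (ps : Vec ℕ k) (cs : Vec (Vec ℕ k) n) → ⊕-Compatible (syndrome ps cs)
syndrome-compat ps cs {u} {u′} {v} {v′} u≡u′ v≡v′ = begin
  residues ps (combination cs (u ⊕ v))                 ≡⟨ cong (residues ps) (combination-⊕ cs u v) ⟩
  residues ps (combination cs u ⊕ combination cs v)    ≡⟨ residues-compat ps u≡u′ v≡v′ ⟩
  residues ps (combination cs u′ ⊕ combination cs v′)  ≡⟨ cong (residues ps) (combination-⊕ cs u′ v′) ⟨
  residues ps (combination cs (u′ ⊕ v′))               ∎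
  where open ≡-Reasoning

nonzeroᵇ : ℤ → Bool
nonzeroᵇ (+ zero) = false
nonzeroᵇ _        = true

reduce : ∀ {k} → Vec ℕ k → Vec ℤ k → Vec ℤ k
reduce ps a = V.map +_ (residues ps a)

nonzero-propagates : ∀ {n nz} t (y : Vec ℤ n) → T nz ⊎ t ∷ y ≢ 𝟎 → T (nz ∨ nonzeroᵇ t) ⊎ y ≢ 𝟎
nonzero-propagates              _        _ (inj₁ T-nz) = inj₁ (Equivalence.from T-∨ (inj₁ T-nz))
nonzero-propagates              (+ zero) _ (inj₂ x≢𝟎) = inj₂ (x≢𝟎 ∘ cong (+ 0 ∷_))
nonzero-propagates {nz = nz}    +[1+ _ ] _ (inj₂ _)   = inj₁ (Equivalence.from (T-∨ {nz}) (inj₂ _))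
nonzero-propagates {nz = nz}    -[1+ _ ] _ (inj₂ _)   = inj₁ (Equivalence.from (T-∨ {nz}) (inj₂ _))

-- The partial sum is kept reduced, which keeps the exhaustive search fast.
kernelHit : ∀ {k n} → Vec ℕ k → Vec (Vec ℕ k) n → Bool → ℕ → Vec ℤ k → Bool
kernelHit ps []       nz b a = nz ∧ ⌊ VP.≡-dec ℕ._≟_ (residues ps a) (residues ps 𝟎) ⌋
kernelHit ps (c ∷ cs) nz b a =
  any (λ t → kernelHit ps cs (nz ∨ nonzeroᵇ t) (b ∸ ∣ t ∣) (reduce ps (a ⊕ scale t c))) (range b)

kernelHit-sound : ∀ {k n} (ps : Vec ℕ k) (cs : Vec (Vec ℕ k) n) {nz b} a x →
                  ¬ T (kernelHit ps cs nz b a) → leeWeight x ≤ b → T nz ⊎ x ≢ 𝟎 →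
                  residues ps (a ⊕ combination cs x) ≢ residues ps 𝟎
kernelHit-sound {k} ps [] {nz} a [] no-hit _ nz⊎x≢𝟎 hit =
  no-hit (Equivalence.from T-∧ (nz-holds nz⊎x≢𝟎 , fromWitness (trans (cong (residues ps) (sym (identityʳ a))) hit)))
  where
  open ℤⁿ k using (identityʳ)
  nz-holds : T nz ⊎ [] ≢ 𝟎 → T nz
  nz-holds (inj₁ T-nz)  = T-nz
  nz-holds (inj₂ []≢[]) = contradiction refl []≢[]
kernelHit-sound {k} ps (c ∷ cs) {nz} {b} a (t ∷ y) no-hit ∣t∣+∣y∣≤b nz⊎x≢𝟎 hit =
  kernelHit-sound ps cs a′ y no-hit′ ∣y∣≤b-∣t∣ (nonzero-propagates t y nz⊎x≢𝟎) hit′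
  where
  open ℤⁿ k using (assoc)
  a′ = reduce ps (a ⊕ scale t c)
  no-hit′ : ¬ T (kernelHit ps cs (nz ∨ nonzeroᵇ t) (b ∸ ∣ t ∣) a′)
  no-hit′ = no-hit ∘ any⁺ _ ∘ lose (∣∣≤⇒∈range t (ℕP.m+n≤o⇒m≤o ∣ t ∣ ∣t∣+∣y∣≤b))
  ∣y∣≤b-∣t∣ : leeWeight y ≤ b ∸ ∣ t ∣
  ∣y∣≤b-∣t∣ = ℕP.m+n≤o⇒m≤o∸n (leeWeight y) (subst (_≤ b) (ℕP.+-comm ∣ t ∣ (leeWeight y)) ∣t∣+∣y∣≤b)
  hit′ : residues ps (a′ ⊕ combination cs y) ≡ residues ps 𝟎
  hit′ = begin
    residues ps (a′ ⊕ combination cs y)                  ≡⟨ residues-compat ps (residues-idem ps (a ⊕ scale t c)) refl ⟩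
    residues ps ((a ⊕ scale t c) ⊕ combination cs y)     ≡⟨ cong (residues ps) (assoc a (scale t c) (combination cs y)) ⟩
    residues ps (a ⊕ (scale t c ⊕ combination cs y))     ≡⟨ hit ⟩
    residues ps 𝟎                                        ∎
    where open ≡-Reasoning

-- ℤ₂ × ℤ₃⁵
moduli : Vec ℕ 6
moduli = 1 ∷ 2 ∷ 2 ∷ 2 ∷ 2 ∷ 2 ∷ []

columns : Vec (Vec ℕ 6) 11
columns =
    (1 ∷ 1 ∷ 0 ∷ 0 ∷ 0 ∷ 0 ∷ [])
  ∷ (1 ∷ 0 ∷ 1 ∷ 0 ∷ 0 ∷ 0 ∷ [])
  ∷ (1 ∷ 0 ∷ 0 ∷ 1 ∷ 0 ∷ 0 ∷ [])
  ∷ (1 ∷ 0 ∷ 0 ∷ 0 ∷ 1 ∷ 0 ∷ [])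
  ∷ (1 ∷ 0 ∷ 0 ∷ 0 ∷ 0 ∷ 1 ∷ [])
  ∷ (1 ∷ 1 ∷ 0 ∷ 2 ∷ 1 ∷ 2 ∷ [])
  ∷ (1 ∷ 2 ∷ 1 ∷ 1 ∷ 1 ∷ 2 ∷ [])
  ∷ (1 ∷ 2 ∷ 2 ∷ 2 ∷ 0 ∷ 2 ∷ [])
  ∷ (1 ∷ 2 ∷ 2 ∷ 0 ∷ 1 ∷ 1 ∷ [])
  ∷ (1 ∷ 1 ∷ 2 ∷ 1 ∷ 1 ∷ 0 ∷ [])
  ∷ (1 ∷ 0 ∷ 1 ∷ 2 ∷ 1 ∷ 1 ∷ [])
  ∷ []

e₁ : Vec ℤ 11
e₁ = + 1 ∷ 𝟎

no-short-kernel-vector : ¬ T (kernelHit moduli columns false 5 𝟎)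
no-short-kernel-vector ()

open CompatibleMap (syndrome moduli columns) (λ {u u′ v v′} → syndrome-compat moduli columns {u} {u′} {v} {v′})

kernel-weight≥6 : ∀ {x} → Kernel x → x ≢ 𝟎 → 6 ≤ leeWeight x
-- Here syndrome 𝟎 and residues moduli 𝟎 agree by evaluation.
kernel-weight≥6 {x} x∈K x≢𝟎 with leeWeight x ≤? 5
... | no  ∣x∣≰5 = ℕP.≰⇒> ∣x∣≰5
... | yes ∣x∣≤5 = contradiction (trans (cong (residues moduli) (identityˡ (combination columns x))) x∈K)
                    (kernelHit-sound moduli columns {false} {5} 𝟎 x no-short-kernel-vector ∣x∣≤5 (inj₂ x≢𝟎))
  where open ℤⁿ 6 using (identityˡ)

-- Both the residue vectors and the double ball number 486 = 2 · 3⁵.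
open Tiling (VP.≡-dec ℕP._≟_) (residueVectors moduli) (residueVectors-unique moduli)
            (residues∈residueVectors moduli ∘ combination columns)
            (doubleBall e₁ 2) (doubleBall-isAnticode e₁ 2) ℕP.≤-refl kernel-weight≥6

proposition8 : Σ (Vec ℤ 11 → Set) (λ C → IsLinearDPL 11 6 C)
proposition8 = Kernel , kernel-isLinearDPL
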